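{- For every integer $n \ge 1$ there exists a polynomial $P(X_1,\ldots,X_n) \in \mathbb{R}[X_1,\ldots,X_n]$ that sign represents the parity function over $\{1,2\}^n$, has total degree $n^2$ and has sparsity $n+1$.
   Context: For $A \subseteq \mathbb{Z}$, the parity function $\mathrm{Par}: A^n \to \{0,1\}$ is $\mathrm{Par}(a_1,\ldots,a_n) = \sum_{i=1}^n a_i \bmod 2$. A polynomial $P$ sign represents $f: A^n \to \{0,1\}$ if for every $a \in A^n$: $f(a) = 0 \Rightarrow P(a) > 0$ and $f(a) = 1 \Rightarrow P(a) < 0$. The sparsity of $P$ is the number of monomials with nonzero coefficient in the standard monomial basis. -}

module Defs where

open import Data.Nat as ℕ using (ℕ; _⊔_; _%_)
open import Data.Integer as ℤ using (ℤ; _<_; _>_)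
open import Data.Vec using (Vec; []; _∷_; zipWith; toList)
open import Data.List as L using (List; length; map; foldr)
open import Data.List.Relation.Unary.All using (All)
open import Data.List.Relation.Unary.Unique.Propositional using (Unique)
open import Data.Product using (_×_; proj₁; proj₂)
open import Data.Sum using (_⊎_)
open import Relation.Binary.PropositionalEquality using (_≡_; _≢_)

Term : ℕ → Set
Term n = ℤ × Vec ℕ n

Poly : ℕ → Set
Poly n = List (Term n)

-- For such a representation the list of terms is exactly the list of monomials
-- with nonzero coefficient in the standard monomial basis.
Canonical : ∀ {n} → Poly n → Set
Canonical P = All (λ t → proj₁ t ≢ ℤ.0ℤ) P × Unique (map proj₂ P)

-- Sparsity: number of monomials with nonzero coefficient (for canonical P).
sparsity : ∀ {n} → Poly n → ℕ
sparsity P = length P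

monoDeg : ∀ {n} → Vec ℕ n → ℕ
monoDeg e = foldr ℕ._+_ 0 (toList e)

totalDegree : ∀ {n} → Poly n → ℕ
totalDegree P = foldr (λ t d → monoDeg (proj₂ t) ⊔ d) 0 P

evalMono : ∀ {n} → Vec ℤ n → Vec ℕ n → ℤ
evalMono a e = foldr ℤ._*_ ℤ.1ℤ (toList (zipWith ℤ._^_ a e))

eval : ∀ {n} → Poly n → Vec ℤ n → ℤ
eval P a = foldr (λ t s → proj₁ t ℤ.* evalMono a (proj₂ t) ℤ.+ s) ℤ.0ℤ P

InA : ℤ → Set
InA v = (v ≡ ℤ.+ 1) ⊎ (v ≡ ℤ.+ 2)

Par : ∀ {n} → Vec ℤ n → ℕ
Par a = ℤ.∣ foldr ℤ._+_ ℤ.0ℤ (toList a) ∣ % 2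

SignRepresents : ∀ {n} → Poly n → (Vec ℤ n → ℕ) → Set
SignRepresents {n} P f =
  (a : Vec ℤ n) → Data.Vec.Relation.Unary.All.All InA a →
    (f a ≡ 0 → eval P a > ℤ.0ℤ) × (f a ≡ 1 → eval P a < ℤ.0ℤ)
  where import Data.Vec.Relation.Unary.All

{-# OPTIONS --safe #-}
-- Take P = Q(X₁⋯Xₙ) with Q(Y) = ∏_{k<n} (2Y − 3·2^k).  At a point of {1,2}ⁿ with m coordinates
-- equal to 2 the product X₁⋯Xₙ is 2^m, and the factor 2·2^m − 3·2^k is positive exactly when
-- k < m.  So Q has the sign (−1)^(n−m), and n − m, the number of ones, has the parity of
-- a₁ + ⋯ + aₙ.  All roots of Q are positive, hence its n + 1 coefficients alternate in sign and
-- none vanishes: P has exactly the monomials (X₁⋯Xₙ)^j, 0 ≤ j ≤ n, of degree n j.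
module Submission where

open import Defs
open import Data.Nat as ℕ using (ℕ; zero; suc; z≤n; s≤s; _%_)
import Data.Nat.Properties as ℕₚ
open import Data.Nat.DivMod using ([m+kn]%n≡m%n)
open import Data.Integer as ℤ using (ℤ; +_; 0ℤ; 1ℤ)
import Data.Integer.Properties as ℤₚ
open import Data.Integer.Solver using (module +-*-Solver)
open import Data.Vec using (Vec; []; _∷_; replicate; toList)
import Data.Vec.Properties as Vecₚ
open import Data.Vec.Relation.Unary.All as Vec using ([]; _∷_)
open import Data.List using (List; []; _∷_; length; map; foldr)
open import Data.List.Properties using (length-map)
open import Data.List.Relation.Unary.All using (All; []; _∷_)
open import Data.List.Relation.Unary.All.Properties using (map⁻)
open import Data.List.Relation.Unary.AllPairs using ([]; _∷_)
open import Data.List.Relation.Unary.Unique.Propositional using (Unique)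
open import Data.Product using (Σ; ∃; _×_; _,_; proj₁; proj₂)
open import Data.Sum using (inj₁; inj₂)
open import Relation.Binary.PropositionalEquality
  using (_≡_; _≢_; refl; sym; trans; cong; cong₂; subst; subst₂)

module _ where
  open import Data.Integer using (_+_; _*_; -_; _-_; _<_; _≤_)
  open +-*-Solver using (solve; _:=_; con; _:+_; _:*_; _:-_; :-_)

  private variable
    i j : ℤ

  pos*pos⇒pos : 0ℤ < i → 0ℤ < j → 0ℤ < i * j
  pos*pos⇒pos {i} i>0 j>0 =
    subst (_< i * _) (ℤₚ.*-zeroʳ i) (ℤₚ.*-monoˡ-<-pos i {{ℤ.positive i>0}} j>0)

  pos*neg⇒neg : 0ℤ < i → j < 0ℤ → i * j < 0ℤ
  pos*neg⇒neg {i} i>0 j<0 =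
    subst (i * _ <_) (ℤₚ.*-zeroʳ i) (ℤₚ.*-monoˡ-<-pos i {{ℤ.positive i>0}} j<0)

  neg*pos⇒neg : i < 0ℤ → 0ℤ < j → i * j < 0ℤ
  neg*pos⇒neg {j = j} i<0 j>0 = ℤₚ.*-monoʳ-<-pos j {{ℤ.positive j>0}} i<0

  neg*neg⇒pos : i < 0ℤ → j < 0ℤ → 0ℤ < i * j
  neg*neg⇒pos {i} i<0 j<0 =
    subst (_< i * _) (ℤₚ.*-zeroʳ i) (ℤₚ.*-monoˡ-<-neg i {{ℤ.negative i<0}} j<0)

  nonNeg*nonNeg⇒nonNeg : 0ℤ ≤ i → 0ℤ ≤ j → 0ℤ ≤ i * j
  nonNeg*nonNeg⇒nonNeg {i} i≥0 j≥0 =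
    subst (_≤ i * _) (ℤₚ.*-zeroʳ i) (ℤₚ.*-monoˡ-≤-nonNeg i {{ℤ.nonNegative i≥0}} j≥0)

  0<i*j⇒j≢0 : 0ℤ < i * j → j ≢ 0ℤ
  0<i*j⇒j≢0 {i} i*j>0 refl = ℤₚ.<-irrefl (sym (ℤₚ.*-zeroʳ i)) i*j>0

  i<j⇒0<j-i : i < j → 0ℤ < j - i
  i<j⇒0<j-i {i} {j} i<j = subst (_< j - i) (ℤₚ.+-inverseʳ i) (ℤₚ.+-monoˡ-< (- i) i<j)

  i<j⇒i-j<0 : i < j → i - j < 0ℤ
  i<j⇒i-j<0 {i} {j} i<j = subst (i - j <_) (ℤₚ.+-inverseʳ j) (ℤₚ.+-monoˡ-< (- j) i<j)

  ⟦_⟧ : List ℤ → ℤ → ℤ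
  ⟦ [] ⟧ y = 0ℤ
  ⟦ c ∷ cs ⟧ y = c + y * ⟦ cs ⟧ y

  -- Coefficient i of (b Y − r)·c(Y) is b c₍ᵢ₋₁₎ − r cᵢ; the extra argument carries c₍ᵢ₋₁₎.
  mulLinearCarry : (b r : ℤ) → ℤ → List ℤ → List ℤ
  mulLinearCarry b r p [] = b * p ∷ []
  mulLinearCarry b r p (c ∷ cs) = b * p - r * c ∷ mulLinearCarry b r c cs

  mulLinear : (b r : ℤ) → List ℤ → List ℤ
  mulLinear b r = mulLinearCarry b r 0ℤ

  ⟦mulLinearCarry⟧ : ∀ b r p cs y → ⟦ mulLinearCarry b r p cs ⟧ y ≡ b * p + (b * y - r) * ⟦ cs ⟧ y
  ⟦mulLinearCarry⟧ b r p [] y =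
    solve 4 (λ b r p y → b :* p :+ y :* con 0ℤ := b :* p :+ (b :* y :- r) :* con 0ℤ) refl b r p y
  ⟦mulLinearCarry⟧ b r p (c ∷ cs) y rewrite ⟦mulLinearCarry⟧ b r c cs y =
    solve 6 (λ b r p c y e → b :* p :- r :* c :+ y :* (b :* c :+ (b :* y :- r) :* e)
                            := b :* p :+ (b :* y :- r) :* (c :+ y :* e))
      refl b r p c y (⟦ cs ⟧ y)

  ⟦mulLinear⟧ : ∀ b r cs y → ⟦ mulLinear b r cs ⟧ y ≡ (b * y - r) * ⟦ cs ⟧ y
  ⟦mulLinear⟧ b r cs y rewrite ⟦mulLinearCarry⟧ b r 0ℤ cs y | ℤₚ.*-zeroʳ b = ℤₚ.+-identityˡ _

  length-mulLinearCarry : ∀ b r p cs → length (mulLinearCarry b r p cs) ≡ suc (length cs)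
  length-mulLinearCarry b r p [] = refl
  length-mulLinearCarry b r p (c ∷ cs) = cong suc (length-mulLinearCarry b r c cs)

  data Alternating (s : ℤ) : List ℤ → Set where
    [_] : ∀ {c} → 0ℤ < s * c → Alternating s (c ∷ [])
    _∷_ : ∀ {c cs} → 0ℤ < s * c → Alternating (- s) cs → Alternating s (c ∷ cs)

  Alternating⇒nonZero : ∀ {s cs} → Alternating s cs → All (_≢ 0ℤ) cs
  Alternating⇒nonZero {s} [ sc>0 ] = 0<i*j⇒j≢0 {s} sc>0 ∷ []
  Alternating⇒nonZero {s} (sc>0 ∷ alt) = 0<i*j⇒j≢0 {s} sc>0 ∷ Alternating⇒nonZero alt

  s*[b*p-r*c]>0 : ∀ {b r} s p c → 0ℤ < b → 0ℤ < r → 0ℤ ≤ s * p → 0ℤ < - s * c →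
    0ℤ < s * (b * p - r * c)
  s*[b*p-r*c]>0 {b} {r} s p c b>0 r>0 sp≥0 -sc>0 = subst (0ℤ <_)
    (solve 5 (λ b r s p c → b :* (s :* p) :+ r :* (:- s :* c) := s :* (b :* p :- r :* c))
      refl b r s p c)
    (ℤₚ.+-mono-≤-< (nonNeg*nonNeg⇒nonNeg (ℤₚ.<⇒≤ b>0) sp≥0) (pos*pos⇒pos r>0 -sc>0))

  mulLinearCarry-alternating : ∀ {b r} s p cs → 0ℤ < b → 0ℤ < r → 0ℤ ≤ s * p →
    Alternating (- s) cs → Alternating s (mulLinearCarry b r p cs)
  mulLinearCarry-alternating {b} s p (c ∷ []) b>0 r>0 sp≥0 [ -sc>0 ] =
    s*[b*p-r*c]>0 s p c b>0 r>0 sp≥0 -sc>0 ∷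
    [ subst (0ℤ <_) b*[-sc]≡-s*[bc] (pos*pos⇒pos b>0 -sc>0) ]
    where
    b*[-sc]≡-s*[bc] : b * (- s * c) ≡ - s * (b * c)
    b*[-sc]≡-s*[bc] = solve 3 (λ b s c → b :* (:- s :* c) := :- s :* (b :* c)) refl b s c
  mulLinearCarry-alternating s p (c ∷ cs) b>0 r>0 sp≥0 (-sc>0 ∷ alt) =
    s*[b*p-r*c]>0 s p c b>0 r>0 sp≥0 -sc>0 ∷
    mulLinearCarry-alternating (- s) c cs b>0 r>0 (ℤₚ.<⇒≤ -sc>0) alt

module _ where
  open import Data.Nat using (_+_; _*_; _^_; _<_; _≤_)

  3*2^k<2^[1+m] : ∀ {k m} → k < m → 3 * 2 ^ k < 2 ^ suc m
  3*2^k<2^[1+m] {k} k<m = ℕₚ.<-≤-trans 3*2^k<4*2^k (ℕₚ.*-monoʳ-≤ 2 (ℕₚ.^-monoʳ-≤ 2 k<m))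
    where
    3*2^k<4*2^k : 3 * 2 ^ k < 2 * (2 * 2 ^ k)
    3*2^k<4*2^k = subst (3 * 2 ^ k <_) (ℕₚ.*-assoc 2 2 (2 ^ k))
      (ℕₚ.*-monoˡ-< (2 ^ k) {{ℕₚ.m^n≢0 2 k}} {3} {4} ℕₚ.≤-refl)

  2^[1+m]<3*2^k : ∀ {k m} → m ≤ k → 2 ^ suc m < 3 * 2 ^ k
  2^[1+m]<3*2^k {k} m≤k =
    ℕₚ.≤-<-trans (ℕₚ.*-monoʳ-≤ 2 (ℕₚ.^-monoʳ-≤ 2 m≤k)) (ℕₚ.m<n+m (2 * 2 ^ k) (ℕₚ.m^n>0 2 k))

module _ where
  open import Data.Integer using (_+_; _*_; -_; _-_; _<_)

  root : ℕ → ℤ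
  root k = + (3 ℕ.* 2 ℕ.^ k)

  factor : ℕ → ℤ → ℤ
  factor k y = + 2 * y - root k

  Q : ℕ → ℤ → ℤ
  Q zero y = 1ℤ
  Q (suc k) y = factor k y * Q k y

  Q-coefficients : ℕ → List ℤ
  Q-coefficients zero = 1ℤ ∷ []
  Q-coefficients (suc k) = mulLinear (+ 2) (root k) (Q-coefficients k)

  ⟦Q-coefficients⟧ : ∀ k y → ⟦ Q-coefficients k ⟧ y ≡ Q k y
  ⟦Q-coefficients⟧ zero y = cong (λ t → 1ℤ + t) (ℤₚ.*-zeroʳ y)
  ⟦Q-coefficients⟧ (suc k) y =
    trans (⟦mulLinear⟧ (+ 2) (root k) (Q-coefficients k) y)
      (cong (factor k y *_) (⟦Q-coefficients⟧ k y))

  length-Q-coefficients : ∀ k → length (Q-coefficients k) ≡ suc k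
  length-Q-coefficients zero = refl
  length-Q-coefficients (suc k) =
    trans (length-mulLinearCarry _ _ 0ℤ (Q-coefficients k)) (cong suc (length-Q-coefficients k))

  Q-coefficients-alternating : ∀ k → ∃ λ s → Alternating s (Q-coefficients k)
  Q-coefficients-alternating zero = 1ℤ , [ ℤ.+<+ (s≤s z≤n) ]
  Q-coefficients-alternating (suc k) with Q-coefficients-alternating k
  ... | s , alt = - s , mulLinearCarry-alternating (- s) 0ℤ (Q-coefficients k)
    (ℤ.+<+ (s≤s z≤n)) root>0 (ℤₚ.≤-reflexive (sym (ℤₚ.*-zeroʳ (- s))))
    (subst (λ t → Alternating t (Q-coefficients k)) (sym (ℤₚ.neg-involutive s)) alt)
    where
    root>0 : 0ℤ < root k
    root>0 = ℤ.+<+ (ℕₚ.*-monoʳ-< 3 (ℕₚ.m^n>0 2 k))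

  pow2 : ℕ → ℤ
  pow2 m = + (2 ℕ.^ m)

  factor-pow2 : ∀ k m → factor k (pow2 m) ≡ pow2 (suc m) - root k
  factor-pow2 k m = cong (_- root k) (sym (ℤₚ.pos-* 2 (2 ℕ.^ m)))

  -- The root of factor k is 3·2^(k-1), strictly between 2^k and 2^(k+1).
  factor>0 : ∀ k m → k ℕ.< m → 0ℤ < factor k (pow2 m)
  factor>0 k m k<m =
    subst (0ℤ <_) (sym (factor-pow2 k m)) (i<j⇒0<j-i (ℤ.+<+ (3*2^k<2^[1+m] k<m)))

  factor<0 : ∀ k m → m ℕ.≤ k → factor k (pow2 m) < 0ℤ
  factor<0 k m m≤k =
    subst (_< 0ℤ) (sym (factor-pow2 k m)) (i<j⇒i-j<0 (ℤ.+<+ (2^[1+m]<3*2^k m≤k)))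

  Q>0 : ∀ k m → k ℕ.≤ m → 0ℤ < Q k (pow2 m)
  Q>0 zero m _ = ℤ.+<+ (s≤s z≤n)
  Q>0 (suc k) m k<m = pos*pos⇒pos (factor>0 k m k<m) (Q>0 k m (ℕₚ.<⇒≤ k<m))

  -- SignRepresents P f unfolds to ∀ a → Vec.All InA a → SignedBy (f a) (eval P a).
  SignedBy : ℕ → ℤ → Set
  SignedBy b z = (b ≡ 0 → 0ℤ < z) × (b ≡ 1 → z < 0ℤ)

  SignedBy-*-pos : ∀ {b w z} → 0ℤ < w → SignedBy b z → SignedBy b (w * z)
  SignedBy-*-pos w>0 (z>0 , z<0) =
    (λ b≡0 → pos*pos⇒pos w>0 (z>0 b≡0)) , (λ b≡1 → pos*neg⇒neg w>0 (z<0 b≡1))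

  Q-signedBy : ∀ d m → SignedBy (d % 2) (Q (d ℕ.+ m) (pow2 m))
  Q-signedBy zero m = (λ _ → Q>0 m m ℕₚ.≤-refl) , (λ ())
  Q-signedBy (suc zero) m =
    (λ ()) , (λ _ → neg*pos⇒neg (factor<0 m m ℕₚ.≤-refl) (Q>0 m m ℕₚ.≤-refl))
  Q-signedBy (suc (suc d)) m =
    subst (SignedBy (d % 2)) (ℤₚ.*-assoc (factor (suc k) y) (factor k y) (Q k y))
      (SignedBy-*-pos
        (neg*neg⇒pos (factor<0 (suc k) m (ℕₚ.m≤n+m m (suc d))) (factor<0 k m (ℕₚ.m≤n+m m d)))
        (Q-signedBy d m))
    where
    k : ℕ
    k = d ℕ.+ m
    y : ℤ
    y = pow2 m

module _ where
  open import Data.Nat using (_+_; _*_; _<_)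

  diagonal : (n j : ℕ) → List ℤ → Poly n
  diagonal n j [] = []
  diagonal n j (c ∷ cs) = (c , replicate n j) ∷ diagonal n (suc j) cs

  coefficients-diagonal : ∀ n j cs → map proj₁ (diagonal n j cs) ≡ cs
  coefficients-diagonal n j [] = refl
  coefficients-diagonal n j (c ∷ cs) = cong (c ∷_) (coefficients-diagonal n (suc j) cs)

  length-diagonal : ∀ n j cs → length (diagonal n j cs) ≡ length cs
  length-diagonal n j cs =
    trans (sym (length-map proj₁ (diagonal n j cs))) (cong length (coefficients-diagonal n j cs))

  exponents-diagonal-fresh : ∀ n {i j} cs → i < j →
    All (replicate (suc n) i ≢_) (map proj₂ (diagonal (suc n) j cs))
  exponents-diagonal-fresh n [] i<j = []
  exponents-diagonal-fresh n (c ∷ cs) i<j =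
    (λ eq → ℕₚ.<⇒≢ i<j (Vecₚ.∷-injectiveˡ eq)) ∷ exponents-diagonal-fresh n cs (ℕₚ.m<n⇒m<1+n i<j)

  exponents-diagonal-unique : ∀ n j cs → Unique (map proj₂ (diagonal (suc n) j cs))
  exponents-diagonal-unique n j [] = []
  exponents-diagonal-unique n j (c ∷ cs) =
    exponents-diagonal-fresh n cs ℕₚ.≤-refl ∷ exponents-diagonal-unique n (suc j) cs

  monoDeg-replicate : ∀ n j → monoDeg (replicate n j) ≡ n * j
  monoDeg-replicate zero j = refl
  monoDeg-replicate (suc n) j = cong (λ t → j + t) (monoDeg-replicate n j)

  totalDegree-diagonal : ∀ n j cs {k} → length cs ≡ suc k →
    totalDegree (diagonal n j cs) ≡ n * (j + k)
  totalDegree-diagonal n j (c ∷ []) {zero} refl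
    rewrite monoDeg-replicate n j | ℕₚ.+-identityʳ j = ℕₚ.⊔-identityʳ (n * j)
  totalDegree-diagonal n j (c ∷ c′ ∷ cs) {suc k} eq
    rewrite monoDeg-replicate n j
          | totalDegree-diagonal n (suc j) (c′ ∷ cs) (ℕₚ.suc-injective eq)
          | sym (ℕₚ.+-suc j k) =
    ℕₚ.m≤n⇒m⊔n≡n (ℕₚ.*-monoʳ-≤ n (ℕₚ.m≤m+n j (suc k)))

module _ where
  open import Data.Integer using (_+_; _*_; _^_)
  open +-*-Solver using (solve; _:=_; con; _:+_; _:*_)
  open import Algebra.Properties.CommutativeSemigroup ℤₚ.*-commutativeSemigroup using (interchange)

  ∏ : ∀ {n} → Vec ℤ n → ℤ
  ∏ a = foldr _*_ 1ℤ (toList a)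

  ∑ : ∀ {n} → Vec ℤ n → ℤ
  ∑ a = foldr _+_ 0ℤ (toList a)

  ^-distribʳ-* : ∀ x y j → (x * y) ^ j ≡ x ^ j * y ^ j
  ^-distribʳ-* x y zero = refl
  ^-distribʳ-* x y (suc j) =
    trans (cong ((x * y) *_) (^-distribʳ-* x y j)) (interchange x y (x ^ j) (y ^ j))

  evalMono-replicate : ∀ {n} (a : Vec ℤ n) j → evalMono a (replicate n j) ≡ ∏ a ^ j
  evalMono-replicate [] j = sym (ℤₚ.^-zeroˡ j)
  evalMono-replicate (x ∷ a) j =
    trans (cong (x ^ j *_) (evalMono-replicate a j)) (sym (^-distribʳ-* x (∏ a) j))

  eval-diagonal : ∀ {n} (a : Vec ℤ n) j cs → eval (diagonal n j cs) a ≡ ∏ a ^ j * ⟦ cs ⟧ (∏ a)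
  eval-diagonal a j [] = sym (ℤₚ.*-zeroʳ (∏ a ^ j))
  eval-diagonal a j (c ∷ cs) rewrite evalMono-replicate a j | eval-diagonal a (suc j) cs =
    solve 4 (λ c y x e → c :* x :+ y :* x :* e := x :* (c :+ y :* e)) refl
      c (∏ a) (∏ a ^ j) (⟦ cs ⟧ (∏ a))

  ones twos : ∀ {n} {a : Vec ℤ n} → Vec.All InA a → ℕ
  ones [] = 0
  ones (inj₁ _ ∷ p) = suc (ones p)
  ones (inj₂ _ ∷ p) = ones p
  twos [] = 0
  twos (inj₁ _ ∷ p) = twos p
  twos (inj₂ _ ∷ p) = suc (twos p)

  ones+twos : ∀ {n} {a : Vec ℤ n} (p : Vec.All InA a) → ones p ℕ.+ twos p ≡ n
  ones+twos [] = refl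
  ones+twos (inj₁ _ ∷ p) = cong suc (ones+twos p)
  ones+twos (inj₂ _ ∷ p) = trans (ℕₚ.+-suc (ones p) (twos p)) (cong suc (ones+twos p))

  ∏≡pow2[twos] : ∀ {n} {a : Vec ℤ n} (p : Vec.All InA a) → ∏ a ≡ pow2 (twos p)
  ∏≡pow2[twos] [] = refl
  ∏≡pow2[twos] (inj₁ refl ∷ p) = trans (ℤₚ.*-identityˡ _) (∏≡pow2[twos] p)
  ∏≡pow2[twos] (inj₂ refl ∷ p) =
    trans (cong (+ 2 *_) (∏≡pow2[twos] p)) (sym (ℤₚ.pos-* 2 (2 ℕ.^ twos p)))

  ∑≡ones+twos*2 : ∀ {n} {a : Vec ℤ n} (p : Vec.All InA a) → ∑ a ≡ + (ones p ℕ.+ twos p ℕ.* 2)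
  ∑≡ones+twos*2 [] = refl
  ∑≡ones+twos*2 (inj₁ refl ∷ p) = cong (λ t → 1ℤ + t) (∑≡ones+twos*2 p)
  ∑≡ones+twos*2 (inj₂ refl ∷ p) =
    trans (cong (λ t → + 2 + t) (∑≡ones+twos*2 p)) (cong +_ 2+[o+t]≡o+[2+t])
    where
    2+[o+t]≡o+[2+t] : 2 ℕ.+ (ones p ℕ.+ twos p ℕ.* 2) ≡ ones p ℕ.+ (2 ℕ.+ twos p ℕ.* 2)
    2+[o+t]≡o+[2+t] = sym (trans (ℕₚ.+-suc (ones p) _) (cong suc (ℕₚ.+-suc (ones p) _)))

  Par≡ones%2 : ∀ {n} {a : Vec ℤ n} (p : Vec.All InA a) → Par a ≡ ones p % 2
  Par≡ones%2 p =
    trans (cong (λ z → ℤ.∣ z ∣ % 2) (∑≡ones+twos*2 p)) ([m+kn]%n≡m%n (ones p) (twos p) 2)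

parityPoly : (n : ℕ) → Poly n
parityPoly n = diagonal n 0 (Q-coefficients n)

eval-parityPoly : ∀ {n} (a : Vec ℤ n) → eval (parityPoly n) a ≡ Q n (∏ a)
eval-parityPoly {n} a =
  trans (eval-diagonal a 0 (Q-coefficients n)) (trans (ℤₚ.*-identityˡ _) (⟦Q-coefficients⟧ n (∏ a)))

parityPoly-signRepresents : ∀ n → SignRepresents (parityPoly n) Par
parityPoly-signRepresents n a p =
  subst₂ SignedBy (sym (Par≡ones%2 p)) (sym eval≡Q) (Q-signedBy (ones p) (twos p))
  where
  eval≡Q : eval (parityPoly n) a ≡ Q (ones p ℕ.+ twos p) (pow2 (twos p))
  eval≡Q = trans (eval-parityPoly a) (cong₂ Q (sym (ones+twos p)) (∏≡pow2[twos] p))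

parityPoly-canonical : ∀ n → Canonical (parityPoly (suc n))
parityPoly-canonical n =
  map⁻ (subst (All (_≢ 0ℤ)) (sym (coefficients-diagonal (suc n) 0 cs))
    (Alternating⇒nonZero (proj₂ (Q-coefficients-alternating (suc n))))) ,
  exponents-diagonal-unique n 0 cs
  where
  cs : List ℤ
  cs = Q-coefficients (suc n)

open import Data.Nat using (_≥_; _*_; _+_)

theorem4p1 : (n : ℕ) → n ≥ 1 →
    Σ (Poly n) λ P →
      Canonical P × SignRepresents P Par ×
      totalDegree P ≡ n * n × sparsity P ≡ n + 1
theorem4p1 (suc n) _ =
  parityPoly (suc n) ,
  parityPoly-canonical n ,
  parityPoly-signRepresents (suc n) ,
  totalDegree-diagonal (suc n) 0 cs (length-Q-coefficients (suc n)) ,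
  trans (length-diagonal (suc n) 0 cs) (trans (length-Q-coefficients (suc n)) (ℕₚ.+-comm 1 (suc n)))
  where
  cs : List ℤ
  cs = Q-coefficients (suc n)
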